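{- Let $D$ be an out-semicomplete digraph and $k$ a positive integer. If $\mathcal{P}$ is a $k$-optimal path partition of $D$, then there exists a partial $k$-coloring of $D$ orthogonal to $\mathcal{P}$.
   Context: Digraphs are finite, without loops or parallel arcs (directed 2-cycles allowed). Vertices $u,v$ are adjacent if $uv$ or $vu$ is an arc. A digraph is semicomplete if every two distinct vertices are adjacent; $D$ is (locally) out-semicomplete if for every vertex $v$ the out-neighborhood $\{u : vu \in A(D)\}$ induces a semicomplete digraph. A path is a nonempty sequence $v_1\dots v_\ell$ of distinct vertices with $v_iv_{i+1}\in A(D)$; its order is $|P|=\ell$. A path partition of $D$ is a set of vertex-disjoint paths covering $V(D)$. The $k$-norm is $|\mathcal{P}|_k=\sum_{P\in\mathcal{P}}\min\{|P|,k\}$; a path partition is $k$-optimal if its $k$-norm is minimum among all path partitions of $D$. A set of vertices is stable if its vertices are pairwise nonadjacent. A partial $k$-coloring of $D$ is a collection of $k$ pairwise disjoint (possibly empty) stable sets (color classes). A path partition $\mathcal{P}$ and a partial $k$-coloring $\mathcal{C}$ are orthogonal if each path $P\in\mathcal{P}$ meets $\min\{|P|,k\}$ distinct color classes of $\mathcal{C}$. -}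

module Defs where

open import Data.Nat using (ℕ; _≤_; _⊓_)
open import Data.Fin using (Fin)
open import Data.Bool using (Bool; true; false)
open import Data.Maybe using (Maybe; just)
open import Data.List using (List; []; _∷_; length; map; concat)
open import Data.Nat.ListAction using (sum)
open import Data.Unit using (⊤)
open import Data.List.Membership.Propositional using (_∈_)
open import Data.List.Relation.Unary.All using (All)
open import Data.List.Relation.Unary.Any using (Any)
open import Data.List.Relation.Unary.Unique.Propositional using (Unique)
open import Data.Product using (Σ; _×_)
open import Data.Sum using (_⊎_)
open import Relation.Binary.PropositionalEquality using (_≡_; _≢_)
open import Relation.Nullary using (¬_)

-- Directed 2-cycles are allowed (arc u v and arc v u).
record Digraph (n : ℕ) : Set where
  field
    arc    : Fin n → Fin n → Bool
    noLoop : ∀ v → arc v v ≡ false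
open Digraph public

Arc : ∀ {n} → Digraph n → Fin n → Fin n → Set
Arc D u v = arc D u v ≡ true

Adjacent : ∀ {n} → Digraph n → Fin n → Fin n → Set
Adjacent D u v = Arc D u v ⊎ Arc D v u

OutSemicomplete : ∀ {n} → Digraph n → Set
OutSemicomplete D = ∀ v u w → Arc D v u → Arc D v w → u ≢ w → Adjacent D u w

Walk : ∀ {n} → Digraph n → List (Fin n) → Set
Walk D []           = ⊤
Walk D (x ∷ [])     = ⊤
Walk D (x ∷ y ∷ xs) = Arc D x y × Walk D (y ∷ xs)

IsPath : ∀ {n} → Digraph n → List (Fin n) → Set
IsPath D P = (P ≢ []) × Unique P × Walk D P

IsPathPartition : ∀ {n} → Digraph n → List (List (Fin n)) → Set
IsPathPartition {n} D 𝒫 =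
  All (IsPath D) 𝒫 × Unique (concat 𝒫) × (∀ (v : Fin n) → v ∈ concat 𝒫)

norm : ∀ {n} → ℕ → List (List (Fin n)) → ℕ
norm k 𝒫 = sum (map (λ P → length P ⊓ k) 𝒫)

KOptimal : ∀ {n} → Digraph n → ℕ → List (List (Fin n)) → Set
KOptimal D k 𝒫 =
  IsPathPartition D 𝒫 × (∀ 𝒬 → IsPathPartition D 𝒬 → norm k 𝒫 ≤ norm k 𝒬)

-- a partial k-colouring: each vertex gets at most one of k colours
-- (colour class i = { v | c v ≡ just i }; classes are disjoint, possibly
-- empty), and each colour class is stable.
Colouring : ℕ → ℕ → Set
Colouring n k = Fin n → Maybe (Fin k)

IsPartialColouring : ∀ {n k} → Digraph n → Colouring n k → Set
IsPartialColouring D c =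
  ∀ u v i → c u ≡ just i → c v ≡ just i → ¬ Adjacent D u v

Meets : ∀ {n k} → Colouring n k → List (Fin n) → Fin k → Set
Meets c P i = Any (λ v → c v ≡ just i) P

MeetsEnough : ∀ {n} (k : ℕ) → Colouring n k → List (Fin n) → Set
MeetsEnough k c P =
  Σ (List (Fin k)) λ cs →
    Unique cs × length cs ≡ length P ⊓ k × All (Meets c P) cs

Orthogonal : ∀ {n} (k : ℕ) → List (List (Fin n)) → Colouring n k → Set
Orthogonal k 𝒫 c = All (MeetsEnough k c) 𝒫

module Submission where

-- By induction on K, and then on the number of paths, every linear forest 𝒫 either admits a
-- linear forest on the same vertices with smaller K-norm, or a partial K-colouring giving
-- distinct colours to the first min(|P|, K) vertices of each path P; for a K-optimal 𝒫 only the
-- latter is possible. If a vertex u has an arc to the head of a path R not containing u, then R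
-- can be spliced into the path of u right after u: by out-semicompleteness the two walks leaving
-- u interleave like sorted lists. If the spliced path is longer than K the K-norm drops,
-- otherwise we recurse on fewer paths. If there is no such arc, the heads form a stable set;
-- they get a fresh colour and the (K-1)-statement is applied to the tails. An improvement Q of
-- the tails is lifted by first reshaping Q (rotating and splicing, which does not increase its
-- norm) until each path of Q starts at the successor of a head, and then putting the heads back.

open import Data.Bool using (true)
import Data.Bool as Bool
open import Data.Empty using (⊥; ⊥-elim)
open import Data.Fin using (Fin; zero; suc)
open import Data.Fin.Properties using (_≟_; suc-injective)
open import Data.List using (List; []; _∷_; _++_; [_]; length; map; concat; concatMap; take; drop; head)
import Data.List.Properties as List
open import Data.List.Membership.Propositional using (_∈_; _∉_; find; lose)
open import Data.List.Membership.Propositional.Properties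
  using (∈-++⁺ˡ; ∈-++⁺ʳ; ∈-++⁻; ∈-∃++; ∈-concat⁺′; ∈-concat⁻′; ∈-concatMap⁺; ∈-concatMap⁻; ∈-map⁺)
import Data.List.Membership.DecPropositional as DecMembership
open import Data.List.Relation.Binary.Disjoint.Propositional using (Disjoint)
open import Data.List.Relation.Binary.Permutation.Propositional
  using (_↭_; ↭-refl; ↭-reflexive; ↭-sym; ↭-trans; ↭-prep; ↭⇒↭ₛ)
import Data.List.Relation.Binary.Permutation.Propositional as ↭
open import Data.List.Relation.Binary.Permutation.Propositional.Properties
  using (++⁺ˡ; ++⁺ʳ; shift; shifts; map⁺; All-resp-↭; ∈-resp-↭; ↭-length)
import Data.List.Relation.Binary.Permutation.Setoid.Properties as Permₛ
import Data.List.Relation.Binary.Sublist.Propositional.Properties as Sublist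
open import Data.List.Relation.Binary.Subset.Propositional using (_⊆_)
open import Data.List.Relation.Unary.All using (All; []; _∷_)
import Data.List.Relation.Unary.All as All
import Data.List.Relation.Unary.All.Properties as All
open import Data.List.Relation.Unary.All.Properties using (¬Any⇒All¬)
import Data.List.Relation.Unary.AllPairs as AllPairs
open import Data.List.Relation.Unary.Any using (Any; here; there; any?)
import Data.List.Relation.Unary.Any as Any
open import Data.List.Relation.Unary.Unique.Propositional using (Unique; []; _∷_)
open import Data.List.Relation.Unary.Unique.Propositional.Properties using (take⁺)
open import Data.Maybe using (just; nothing; maybe)
import Data.Maybe as Maybe
import Data.Maybe.Properties as Maybe
open import Data.Nat using (ℕ; zero; suc; _≤_; _<_; _+_; _⊓_; z≤n; s≤s; z<s; _≤?_; _<?_)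
open import Data.Nat.Induction using (<-wellFounded)
open import Data.Nat.ListAction using (sum)
open import Data.Nat.ListAction.Properties using (sum-↭)
open import Data.Nat.Properties
  using ( ≤-refl; ≤-reflexive; ≤-trans; <⇒≤; <-irrefl; <-≤-trans; ≰⇒>; ≮⇒≥; <⇒≱; n≤1+n; n<1+n
        ; +-comm; +-assoc; +-suc; +-monoˡ-≤; +-monoʳ-≤; +-monoˡ-<; m<m+n; m<n+m
        ; ⊓-comm; ⊓-glb; ⊓-monoʳ-≤; m≤n⇒m⊓n≡m; m≥n⇒m⊓n≡n; +-commutativeSemigroup; module ≤-Reasoning )
open import Algebra.Properties.CommutativeSemigroup +-commutativeSemigroup using (x∙yz≈yx∙z; x∙yz≈y∙xz)
import Data.Product as Product
open import Data.Product using (Σ; ∃; _×_; _,_; proj₁; proj₂)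
open import Data.Sum using (_⊎_; inj₁; inj₂; [_,_]′)
import Data.Sum as Sum
open import Data.Unit using (⊤; tt)
open import Function using (_∘_)
open import Induction.WellFounded using (Acc; acc)
open import Relation.Binary.PropositionalEquality
  using (_≡_; _≢_; refl; sym; trans; cong; subst; subst₂; setoid)
open import Relation.Nullary using (¬_; Dec; yes; no; ¬?; _×-dec_)

open import Defs

module _ {A : Set} where

  Unique-resp-↭ : ∀ {xs ys : List A} → xs ↭ ys → Unique xs → Unique ys
  Unique-resp-↭ p = Permₛ.Unique-resp-↭ (setoid A) (↭⇒↭ₛ p)

  Unique-++⁻ˡ : ∀ xs {ys : List A} → Unique (xs ++ ys) → Unique xs
  Unique-++⁻ˡ []       _          = []
  Unique-++⁻ˡ (x ∷ xs) (x∉ ∷ u) = All.++⁻ˡ xs x∉ ∷ Unique-++⁻ˡ xs u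

  Unique-++⁻ʳ : ∀ xs {ys : List A} → Unique (xs ++ ys) → Unique ys
  Unique-++⁻ʳ []       u       = u
  Unique-++⁻ʳ (x ∷ xs) (_ ∷ u) = Unique-++⁻ʳ xs u

  Unique-++⇒Disjoint : ∀ xs {ys : List A} → Unique (xs ++ ys) → Disjoint xs ys
  Unique-++⇒Disjoint (x ∷ xs) (x∉ ∷ _) (here refl , x∈ys) = All.lookup (All.++⁻ʳ xs x∉) x∈ys refl
  Unique-++⇒Disjoint (x ∷ xs) (_ ∷ u)  (there v∈xs , v∈ys) = Unique-++⇒Disjoint xs u (v∈xs , v∈ys)

  ∈⇒length>0 : ∀ {x : A} {xs} → x ∈ xs → 0 < length xs
  ∈⇒length>0 (here _)  = s≤s z≤n
  ∈⇒length>0 (there _) = s≤s z≤n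

  ∈⇒↭∷ : ∀ {x : A} {xs} → x ∈ xs → ∃ λ ys → xs ↭ x ∷ ys
  ∈⇒↭∷ {x} x∈xs with ∈-∃++ x∈xs
  ... | ys , zs , refl = ys ++ zs , shift x ys zs

  ↭-swap-++ : ∀ (xs ys : List A) {zs} → xs ++ ys ++ zs ↭ (ys ++ xs) ++ zs
  ↭-swap-++ xs ys {zs} = ↭-trans (shifts xs ys) (↭-reflexive (sym (List.++-assoc ys xs zs)))

  concat⁺ : ∀ {xss yss : List (List A)} → xss ↭ yss → concat xss ↭ concat yss
  concat⁺ ↭.refl           = ↭-refl
  concat⁺ (↭.prep xs p)    = ++⁺ˡ xs (concat⁺ p)
  concat⁺ (↭.swap xs ys p) = ↭-trans (shifts xs ys) (++⁺ˡ ys (++⁺ˡ xs (concat⁺ p)))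
  concat⁺ (↭.trans p q)    = ↭-trans (concat⁺ p) (concat⁺ q)

  head-++-∷ : ∀ (xs : List A) {u ys zs} → head (xs ++ u ∷ ys) ≡ head (xs ++ u ∷ zs)
  head-++-∷ []      = refl
  head-++-∷ (_ ∷ _) = refl

  take-⊆ : ∀ m (xs : List A) → take m xs ⊆ xs
  take-⊆ m xs = Sublist.Any-resp-⊆ (Sublist.take-⊆ m xs)

  all-or-any : ∀ {P Q : A → Set} xs → (∀ {x} → x ∈ xs → P x ⊎ Q x) → All P xs ⊎ Any Q xs
  all-or-any []       _ = inj₁ []
  all-or-any (x ∷ xs) classify with classify (here refl) | all-or-any xs (classify ∘ there)
  ... | inj₁ px | inj₁ pxs = inj₁ (px ∷ pxs)
  ... | inj₁ _  | inj₂ qxs = inj₂ (there qxs)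
  ... | inj₂ qx | _        = inj₂ (here qx)

  data Consecutive (u v : A) : List A → Set where
    here  : ∀ {xs} → Consecutive u v (u ∷ v ∷ xs)
    there : ∀ {x xs} → Consecutive u v xs → Consecutive u v (x ∷ xs)

  Consecutive⇒∈ˡ : ∀ {u v xs} → Consecutive u v xs → u ∈ xs
  Consecutive⇒∈ˡ here      = here refl
  Consecutive⇒∈ˡ (there c) = there (Consecutive⇒∈ˡ c)

  Consecutive⇒∈ʳ : ∀ {u v xs} → Consecutive u v xs → v ∈ xs
  Consecutive⇒∈ʳ here      = there (here refl)
  Consecutive⇒∈ʳ (there c) = there (Consecutive⇒∈ʳ c)

  Consecutive-++⁺ˡ : ∀ {u v xs} ys → Consecutive u v xs → Consecutive u v (xs ++ ys)
  Consecutive-++⁺ˡ ys here      = here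
  Consecutive-++⁺ˡ ys (there c) = there (Consecutive-++⁺ˡ ys c)

  Consecutive-++⁺ʳ : ∀ {u v} xs {ys} → Consecutive u v ys → Consecutive u v (xs ++ ys)
  Consecutive-++⁺ʳ []       c = c
  Consecutive-++⁺ʳ (x ∷ xs) c = there (Consecutive-++⁺ʳ xs c)

  Consecutive-concat : ∀ {u v} 𝒫 → Any (Consecutive u v) 𝒫 → Consecutive u v (concat 𝒫)
  Consecutive-concat (P ∷ 𝒫) (here c)  = Consecutive-++⁺ˡ (concat 𝒫) c
  Consecutive-concat (P ∷ 𝒫) (there c) = Consecutive-++⁺ʳ P (Consecutive-concat 𝒫 c)

  Consecutive-functional : ∀ {u v v′ xs} → Unique xs → Consecutive u v xs → Consecutive u v′ xs → v ≡ v′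
  Consecutive-functional _          here      here      = refl
  Consecutive-functional (u∉ ∷ _)   here      (there c) = ⊥-elim (All.lookup u∉ (Consecutive⇒∈ˡ c) refl)
  Consecutive-functional (u∉ ∷ _)   (there c) here      = ⊥-elim (All.lookup u∉ (Consecutive⇒∈ˡ c) refl)
  Consecutive-functional (_ ∷ uniq) (there c) (there c′) = Consecutive-functional uniq c c′

  predecessor : ∀ {v} x xs → v ∈ xs → ∃ λ u → Consecutive u v (x ∷ xs)
  predecessor x (y ∷ xs) (here refl) = x , here
  predecessor x (y ∷ xs) (there v∈xs) = Product.map₂ there (predecessor y xs v∈xs)

module _ {A : Set} where

  ∈-concat-elsewhere : ∀ {R : List A} {𝒬 u} → R ∈ 𝒬 → u ∈ concat 𝒬 → u ∉ R →
                       ∃ λ host → ∃ λ others → u ∈ host × 𝒬 ↭ R ∷ host ∷ others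
  ∈-concat-elsewhere {R} R∈𝒬 u∈𝒬 u∉R with ∈⇒↭∷ R∈𝒬
  ... | rest , 𝒬↭ with ∈-++⁻ R (∈-resp-↭ (concat⁺ 𝒬↭) u∈𝒬)
  ... | inj₁ u∈R    = ⊥-elim (u∉R u∈R)
  ... | inj₂ u∈rest =
    let host , u∈host , host∈rest = ∈-concat⁻′ rest u∈rest
        others , rest↭ = ∈⇒↭∷ host∈rest
    in host , others , u∈host , ↭-trans 𝒬↭ (↭-prep R rest↭)

  heads : List (List A) → List A
  heads = concatMap (take 1)

  tails : List (List A) → List (List A)
  tails = map (drop 1)

  concat-↭-heads++tails : ∀ 𝒫 → concat 𝒫 ↭ heads 𝒫 ++ concat (tails 𝒫)
  concat-↭-heads++tails []             = ↭-refl
  concat-↭-heads++tails ([] ∷ 𝒫)       = concat-↭-heads++tails 𝒫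
  concat-↭-heads++tails ((x ∷ xs) ∷ 𝒫) =
    ↭-prep x (↭-trans (++⁺ˡ xs (concat-↭-heads++tails 𝒫)) (shifts xs (heads 𝒫)))

  ∈-heads⁺ : ∀ {x : A} {xs 𝒫} → x ∷ xs ∈ 𝒫 → x ∈ heads 𝒫
  ∈-heads⁺ R∈𝒫 = ∈-concatMap⁺ (take 1) (Any.map (λ { refl → here refl }) R∈𝒫)

  ∈-heads⁻ : ∀ {x : A} 𝒫 → x ∈ heads 𝒫 → ∃ λ xs → x ∷ xs ∈ 𝒫
  ∈-heads⁻ 𝒫 x∈S with find (∈-concatMap⁻ (take 1) {xs = 𝒫} x∈S)
  ... | _ ∷ xs , R∈𝒫 , here refl = xs , R∈𝒫

  ∈-tails⁺ : ∀ {x : A} {xs 𝒫} → x ∷ xs ∈ 𝒫 → xs ∈ tails 𝒫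
  ∈-tails⁺ = ∈-map⁺ (drop 1)

  predecessor-in-tails : ∀ {v} 𝒫 → v ∈ concat (tails 𝒫) → ∃ λ u → Any (Consecutive u v) 𝒫
  predecessor-in-tails ([] ∷ 𝒫)       v∈ = Product.map₂ there (predecessor-in-tails 𝒫 v∈)
  predecessor-in-tails ((x ∷ xs) ∷ 𝒫) v∈ with ∈-++⁻ xs v∈
  ... | inj₁ v∈xs = Product.map₂ here (predecessor x xs v∈xs)
  ... | inj₂ v∈𝒫  = Product.map₂ there (predecessor-in-tails 𝒫 v∈𝒫)

  removeEmpty : List (List A) → List (List A)
  removeEmpty []             = []
  removeEmpty ([] ∷ 𝒫)       = removeEmpty 𝒫
  removeEmpty ((x ∷ xs) ∷ 𝒫) = (x ∷ xs) ∷ removeEmpty 𝒫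

  concat-removeEmpty : ∀ 𝒫 → concat (removeEmpty 𝒫) ≡ concat 𝒫
  concat-removeEmpty []             = refl
  concat-removeEmpty ([] ∷ 𝒫)       = concat-removeEmpty 𝒫
  concat-removeEmpty ((x ∷ xs) ∷ 𝒫) = cong ((x ∷ xs) ++_) (concat-removeEmpty 𝒫)

⊓-subadditive : ∀ a b K → (a + b) ⊓ K ≤ a ⊓ K + b ⊓ K
⊓-subadditive zero    b K       = ≤-refl
⊓-subadditive (suc a) b zero    = z≤n
⊓-subadditive (suc a) b (suc K) =
  s≤s (≤-trans (⊓-subadditive a b K) (+-monoʳ-≤ (a ⊓ K) (⊓-monoʳ-≤ b (n≤1+n K))))

⊓-strictly-subadditive : ∀ {a b K} → 0 < a → 0 < b → 0 < K → K < a + b → (a + b) ⊓ K < a ⊓ K + b ⊓ K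
⊓-strictly-subadditive {a} {b} {K} a>0 b>0 K>0 K<a+b rewrite m≥n⇒m⊓n≡n (<⇒≤ K<a+b) with K ≤? a | K ≤? b
... | yes K≤a | _ rewrite m≥n⇒m⊓n≡n K≤a = m<m+n K (⊓-glb b>0 K>0)
... | no K≰a | yes K≤b rewrite m≤n⇒m⊓n≡m (<⇒≤ (≰⇒> K≰a)) | m≥n⇒m⊓n≡n K≤b = m<n+m K a>0
... | no K≰a | no K≰b rewrite m≤n⇒m⊓n≡m (<⇒≤ (≰⇒> K≰a)) | m≤n⇒m⊓n≡m (<⇒≤ (≰⇒> K≰b)) = K<a+b

module _ {n : ℕ} (D : Digraph n) where

  private
    V : Set
    V = Fin n

  open DecMembership (_≟_ {n}) using (_∈?_)

  Walk-++⁻ˡ : ∀ (xs : List V) {ys} → Walk D (xs ++ ys) → Walk D xs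
  Walk-++⁻ˡ []           w       = tt
  Walk-++⁻ˡ (x ∷ [])     w       = tt
  Walk-++⁻ˡ (x ∷ y ∷ xs) (a , w) = a , Walk-++⁻ˡ (y ∷ xs) w

  Walk-++⁻ʳ : ∀ (xs : List V) {ys} → Walk D (xs ++ ys) → Walk D ys
  Walk-++⁻ʳ []                   w       = w
  Walk-++⁻ʳ (x ∷ [])     {[]}    _       = tt
  Walk-++⁻ʳ (x ∷ [])     {_ ∷ _} (_ , w) = w
  Walk-++⁻ʳ (x ∷ y ∷ xs)         (_ , w) = Walk-++⁻ʳ (y ∷ xs) w

  Walk-drop : ∀ m (xs : List V) → Walk D xs → Walk D (drop m xs)
  Walk-drop zero    xs       w = w
  Walk-drop (suc m) []       w = tt
  Walk-drop (suc m) (x ∷ xs) w = Walk-drop m xs (Walk-++⁻ʳ [ x ] w)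

  Walk-splice : ∀ (xs : List V) {u ys zs} → Walk D (xs ++ u ∷ ys) → Walk D (u ∷ zs) → Walk D (xs ++ u ∷ zs)
  Walk-splice []           _       w′ = w′
  Walk-splice (x ∷ [])     (a , _) w′ = a , w′
  Walk-splice (x ∷ y ∷ xs) (a , w) w′ = a , Walk-splice (y ∷ xs) w w′

  Consecutive⇒Arc : ∀ {u v xs} → Walk D xs → Consecutive u v xs → Arc D u v
  Consecutive⇒Arc (uv , _) here = uv
  Consecutive⇒Arc {xs = _ ∷ _ ∷ _} (_ , w) (there c) = Consecutive⇒Arc w c

  ArcToHead : V → List V → Set
  ArcToHead u []      = ⊥
  ArcToHead u (r ∷ _) = Arc D u r

  ArcToHead⇒length>0 : ∀ {u R} → ArcToHead u R → 0 < length R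
  ArcToHead⇒length>0 {R = _ ∷ _} _ = s≤s z≤n

  IsLinearForest : List (List V) → Set
  IsLinearForest 𝒫 = All (Walk D) 𝒫 × Unique (concat 𝒫)

  IsLinearForest-resp-↭ : ∀ {𝒫 𝒬} → 𝒫 ↭ 𝒬 → IsLinearForest 𝒫 → IsLinearForest 𝒬
  IsLinearForest-resp-↭ p (walks , unique) = All-resp-↭ p walks , Unique-resp-↭ (concat⁺ p) unique

  norm-↭ : ∀ K {𝒫 𝒬 : List (List V)} → 𝒫 ↭ 𝒬 → norm K 𝒫 ≡ norm K 𝒬
  norm-↭ K p = sum-↭ (map⁺ (λ P → length P ⊓ K) p)

  Improvable : ℕ → List (List V) → Set
  Improvable K 𝒫 = ∃ λ 𝒬 → IsLinearForest 𝒬 × concat 𝒬 ↭ concat 𝒫 × norm K 𝒬 < norm K 𝒫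

  Rainbow : ∀ {K} → Colouring n K → List V → Set
  Rainbow {K} c T = (∀ {v} → v ∈ T → ∃ λ (i : Fin K) → c v ≡ just i)
                  × (∀ {u v} → u ∈ T → v ∈ T → c u ≡ c v → u ≡ v)

  Rainbow-⊆ : ∀ {K} {c : Colouring n K} {T T′} → T ⊆ T′ → Rainbow c T′ → Rainbow c T
  Rainbow-⊆ T⊆T′ (coloured , injective) = coloured ∘ T⊆T′ , λ u∈T v∈T → injective (T⊆T′ u∈T) (T⊆T′ v∈T)

  Rainbow-[] : ∀ {K} {c : Colouring n K} → Rainbow c []
  Rainbow-[] = (λ ()) , λ ()

  Colourable : ℕ → List (List V) → Set
  Colourable K 𝒫 = ∃ λ (c : Colouring n K) → IsPartialColouring D c × All (λ P → Rainbow c (take K P)) 𝒫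

  uncoloured : ∀ 𝒫 → Colourable 0 𝒫
  uncoloured 𝒫 = (λ _ → nothing) , (λ _ _ _ ()) , All.universal (λ _ → Rainbow-[]) 𝒫

  ImprovableOrColourable : ℕ → List (List V) → Set
  ImprovableOrColourable K 𝒫 = Improvable K 𝒫 ⊎ Colourable K 𝒫

  tails-isLinearForest : ∀ {𝒫} → IsLinearForest 𝒫 → IsLinearForest (tails 𝒫)
  tails-isLinearForest {𝒫} (walks , unique) =
    All.map⁺ (All.map (Walk-drop 1 _) walks) ,
    Unique-++⁻ʳ (heads 𝒫) (Unique-resp-↭ (concat-↭-heads++tails 𝒫) unique)

  heads-disjoint-tails : ∀ {𝒫} → IsLinearForest 𝒫 → Disjoint (heads 𝒫) (concat (tails 𝒫))
  heads-disjoint-tails {𝒫} (_ , unique) =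
    Unique-++⇒Disjoint (heads 𝒫) (Unique-resp-↭ (concat-↭-heads++tails 𝒫) unique)

  norm-heads+tails : ∀ k (𝒫 : List (List V)) → norm (suc k) 𝒫 ≡ length (heads 𝒫) + norm k (tails 𝒫)
  norm-heads+tails k []             = refl
  norm-heads+tails k ([] ∷ 𝒫)       = norm-heads+tails k 𝒫
  norm-heads+tails k ((x ∷ xs) ∷ 𝒫) = cong suc (trans (cong (length xs ⊓ k +_) (norm-heads+tails k 𝒫))
                                        (x∙yz≈y∙xz (length xs ⊓ k) (length (heads 𝒫)) (norm k (tails 𝒫))))

  Mergeable : List (List V) → Set
  Mergeable 𝒫 = Any (λ R → Any (λ u → ArcToHead u R × u ∉ R) (concat 𝒫)) 𝒫

  arcToHead? : ∀ u R → Dec (ArcToHead u R)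
  arcToHead? u []      = no λ ()
  arcToHead? u (r ∷ _) = arc D u r Bool.≟ true

  mergeable? : ∀ 𝒫 → Dec (Mergeable 𝒫)
  mergeable? 𝒫 = any? (λ R → any? (λ u → arcToHead? u R ×-dec ¬? (u ∈? R)) (concat 𝒫)) 𝒫

  Unmergeable : List (List V) → Set
  Unmergeable 𝒫 = ∀ {R u} → R ∈ 𝒫 → u ∈ concat 𝒫 → ArcToHead u R → u ∈ R

  ¬mergeable⇒unmergeable : ∀ {𝒫} → ¬ Mergeable 𝒫 → Unmergeable 𝒫
  ¬mergeable⇒unmergeable ¬mergeable {R} {u} R∈𝒫 u∈𝒫 uR with u ∈? R
  ... | yes u∈R = u∈R
  ... | no  u∉R = ⊥-elim (¬mergeable (lose R∈𝒫 (lose u∈𝒫 (uR , u∉R))))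

  -- An arc u → v between heads puts u on the path of v, so u = v or u is not a head.
  heads-stable : ∀ {𝒫} → IsLinearForest 𝒫 → Unmergeable 𝒫 →
                 ∀ {u v} → u ∈ heads 𝒫 → v ∈ heads 𝒫 → ¬ Adjacent D u v
  heads-stable {𝒫} F unmergeable u∈S v∈S (inj₁ uv) = no-arc u∈S v∈S uv
    where
    no-arc : ∀ {u v} → u ∈ heads 𝒫 → v ∈ heads 𝒫 → ¬ Arc D u v
    no-arc {u} u∈S v∈S uv with ∈-heads⁻ 𝒫 v∈S
    ... | vs , v∷vs∈𝒫 with unmergeable v∷vs∈𝒫 (∈-resp-↭ (↭-sym (concat-↭-heads++tails 𝒫)) (∈-++⁺ˡ u∈S)) uv
    no-arc {u} u∈S v∈S uv | vs , v∷vs∈𝒫 | here refl with trans (sym uv) (noLoop D u)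
    ... | ()
    no-arc {u} u∈S v∈S uv | vs , v∷vs∈𝒫 | there u∈vs =
      heads-disjoint-tails F (u∈S , ∈-concat⁺′ u∈vs (∈-tails⁺ v∷vs∈𝒫))
  heads-stable F unmergeable u∈S v∈S (inj₂ vu) = heads-stable F unmergeable v∈S u∈S (inj₁ vu)

  module _ {k} (S : List V) (c : Colouring n k) where

    extendColouring : Colouring n (suc k)
    extendColouring v with v ∈? S
    ... | yes _ = just zero
    ... | no  _ = Maybe.map suc (c v)

    extend-∈ : ∀ {v} → v ∈ S → extendColouring v ≡ just zero
    extend-∈ {v} v∈S with v ∈? S
    ... | yes _   = refl
    ... | no  v∉S = ⊥-elim (v∉S v∈S)

    extend-∉ : ∀ {v} → v ∉ S → extendColouring v ≡ Maybe.map suc (c v)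
    extend-∉ {v} v∉S with v ∈? S
    ... | yes v∈S = ⊥-elim (v∉S v∈S)
    ... | no  _   = refl

    extend-inv : ∀ {v i} → extendColouring v ≡ just i →
                 (v ∈ S × i ≡ zero) ⊎ (∃ λ j → i ≡ suc j × c v ≡ just j)
    extend-inv {v} eq   with v ∈? S
    extend-inv     refl | yes v∈S = inj₁ (v∈S , refl)
    extend-inv {v} eq   | no  _   with c v
    extend-inv     refl | no  _   | just j = inj₂ (j , refl , refl)

    extend-isPartialColouring : (∀ {u v} → u ∈ S → v ∈ S → ¬ Adjacent D u v) →
                                IsPartialColouring D c → IsPartialColouring D extendColouring
    extend-isPartialColouring stable isColouring u v i cu cv with extend-inv cu | extend-inv cv
    ... | inj₁ (u∈S , _)       | inj₁ (v∈S , _)         = stable u∈S v∈S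
    ... | inj₁ (_ , refl)      | inj₂ (_ , () , _)
    ... | inj₂ (_ , refl , _)  | inj₁ (_ , ())
    ... | inj₂ (j , refl , cu′) | inj₂ (.j , refl , cv′) = isColouring u v j cu′ cv′

    extend-rainbow : ∀ {x T} → x ∈ S → (∀ {v} → v ∈ T → v ∉ S) → Rainbow c T → Rainbow extendColouring (x ∷ T)
    extend-rainbow {x} {T} x∈S T∩S=∅ (coloured , injective) = coloured′ , injective′
      where
      shifted : ∀ {v} (v∈T : v ∈ T) → extendColouring v ≡ just (suc (proj₁ (coloured v∈T)))
      shifted v∈T = trans (extend-∉ (T∩S=∅ v∈T)) (cong (Maybe.map suc) (proj₂ (coloured v∈T)))
      coloured′ : ∀ {v} → v ∈ x ∷ T → ∃ λ i → extendColouring v ≡ just i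
      coloured′ (here refl) = zero , extend-∈ x∈S
      coloured′ (there v∈T) = _ , shifted v∈T
      zero≢suc : ∀ {v} (v∈T : v ∈ T) → extendColouring x ≢ extendColouring v
      zero≢suc v∈T eq with trans (sym (extend-∈ x∈S)) (trans eq (shifted v∈T))
      ... | ()
      injective′ : ∀ {u v} → u ∈ x ∷ T → v ∈ x ∷ T → extendColouring u ≡ extendColouring v → u ≡ v
      injective′ (here refl)  (here refl)  _  = refl
      injective′ (here refl)  (there v∈T) eq = ⊥-elim (zero≢suc v∈T eq)
      injective′ (there u∈T) (here refl)  eq = ⊥-elim (zero≢suc u∈T (sym eq))
      injective′ (there u∈T) (there v∈T) eq =
        injective u∈T v∈T (Maybe.map-injective suc-injective
          (trans (sym (extend-∉ (T∩S=∅ u∈T))) (trans eq (extend-∉ (T∩S=∅ v∈T)))))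

  colourable-by-heads : ∀ {k 𝒫} → IsLinearForest 𝒫 → Unmergeable 𝒫 →
                        Colourable k (tails 𝒫) → Colourable (suc k) 𝒫
  colourable-by-heads {k} {𝒫} F unmergeable (c , isColouring , rainbows) =
    extendColouring S c ,
    extend-isPartialColouring S c (heads-stable F unmergeable) isColouring ,
    All.tabulate (λ P∈𝒫 → extend-path P∈𝒫 (All.lookup (All.map⁻ rainbows) P∈𝒫))
    where
    S : List V
    S = heads 𝒫
    extend-path : ∀ {P} → P ∈ 𝒫 → Rainbow c (take k (drop 1 P)) → Rainbow (extendColouring S c) (take (suc k) P)
    extend-path {[]}     _     _  = Rainbow-[]
    extend-path {x ∷ xs} P∈𝒫 rb = extend-rainbow S c (∈-heads⁺ P∈𝒫)
      (λ v∈T v∈S → heads-disjoint-tails F (v∈S , ∈-concat⁺′ (take-⊆ k xs v∈T) (∈-tails⁺ P∈𝒫))) rb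

  position : V → List V → ℕ
  position v []       = 0
  position v (x ∷ xs) with v ≟ x
  ... | yes _ = 0
  ... | no  _ = suc (position v xs)

  position-< : ∀ {u v xs} → Unique xs → Consecutive u v xs → position u xs < position v xs
  position-< {u} {v} (u∉ ∷ _) here with u ≟ u | v ≟ u
  ... | yes _   | no _     = s≤s z≤n
  ... | no u≢u  | _        = ⊥-elim (u≢u refl)
  ... | yes _   | yes refl = ⊥-elim (All.lookup u∉ (here refl) refl)
  position-< {u} {v} {x ∷ xs} (x∉ ∷ uniq) (there c) with u ≟ x | v ≟ x
  ... | no _     | no _     = s≤s (position-< uniq c)
  ... | yes refl | _        = ⊥-elim (All.lookup x∉ (Consecutive⇒∈ˡ c) refl)
  ... | no _     | yes refl = ⊥-elim (All.lookup x∉ (Consecutive⇒∈ʳ c) refl)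

  rainbow-colours : ∀ {K} {c : Colouring n K} {T} → Unique T → Rainbow c T →
                    ∃ λ cs → Unique cs × length cs ≡ length T × All (Meets c T) cs
  rainbow-colours {T = []}    _          _  = [] , [] , refl , []
  rainbow-colours {T = x ∷ T} (x∉T ∷ uT) rb@(coloured , injective)
    with coloured (here refl) | rainbow-colours uT (Rainbow-⊆ there rb)
  ... | i , cx | cs , ucs , length-cs , meets =
    i ∷ cs , ¬Any⇒All¬ cs i∉cs ∷ ucs , cong suc length-cs , here cx ∷ All.map there meets
    where
    i∉cs : i ∉ cs
    i∉cs i∈cs with find (All.lookup meets i∈cs)
    ... | v , v∈T , cv = All.lookup x∉T v∈T (injective (here refl) (there v∈T) (trans cx (sym cv)))

  rainbow⇒meetsEnough : ∀ K {c : Colouring n K} {P} → Unique P → Rainbow c (take K P) → MeetsEnough K c P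
  rainbow⇒meetsEnough K {P = P} uP rb with rainbow-colours (take⁺ K uP) rb
  ... | cs , ucs , length-cs , meets =
    cs , ucs , trans length-cs (trans (List.length-take K P) (⊓-comm K (length P))) ,
    All.map (Sublist.Any-resp-⊆ (Sublist.take-⊆ K P)) meets

  rainbows⇒orthogonal : ∀ {k 𝒫} {c : Colouring n k} → All (IsPath D) 𝒫 →
                        All (λ P → Rainbow c (take k P)) 𝒫 → Orthogonal k 𝒫 c
  rainbows⇒orthogonal {k} paths rainbows =
    All.zipWith (λ (path , rainbow) → rainbow⇒meetsEnough k (proj₁ (proj₂ path)) rainbow) (paths , rainbows)

  norm-removeEmpty : ∀ K (𝒫 : List (List V)) → norm K (removeEmpty 𝒫) ≡ norm K 𝒫
  norm-removeEmpty K []             = refl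
  norm-removeEmpty K ([] ∷ 𝒫)       = norm-removeEmpty K 𝒫
  norm-removeEmpty K ((x ∷ xs) ∷ 𝒫) = cong (suc (length xs) ⊓ K +_) (norm-removeEmpty K 𝒫)

  removeEmpty-paths : ∀ 𝒫 → IsLinearForest 𝒫 → All (IsPath D) (removeEmpty 𝒫)
  removeEmpty-paths []             _                  = []
  removeEmpty-paths ([] ∷ 𝒫)       ((_ ∷ walks) , u) = removeEmpty-paths 𝒫 (walks , u)
  removeEmpty-paths ((x ∷ xs) ∷ 𝒫) ((w ∷ walks) , u) =
    ((λ ()) , Unique-++⁻ˡ (x ∷ xs) u , w) ∷ removeEmpty-paths 𝒫 (walks , Unique-++⁻ʳ (x ∷ xs) u)

  isPathPartition⇒isLinearForest : ∀ {𝒫} → IsPathPartition D 𝒫 → IsLinearForest 𝒫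
  isPathPartition⇒isLinearForest (paths , unique , _) = All.map (proj₂ ∘ proj₂) paths , unique

  k-optimal⇒¬improvable : ∀ {k 𝒫} → KOptimal D k 𝒫 → ¬ Improvable k 𝒫
  k-optimal⇒¬improvable {k} {𝒫} ((_ , _ , covers) , optimal) (𝒬 , F𝒬 , 𝒬↭ , 𝒬<) =
    <⇒≱ 𝒬< (subst (norm k 𝒫 ≤_) (norm-removeEmpty k 𝒬) (optimal (removeEmpty 𝒬) partition))
    where
    partition : IsPathPartition D (removeEmpty 𝒬)
    partition = removeEmpty-paths 𝒬 F𝒬 ,
                subst Unique (sym (concat-removeEmpty 𝒬)) (proj₂ F𝒬) ,
                λ v → subst (v ∈_) (sym (concat-removeEmpty 𝒬)) (∈-resp-↭ (↭-sym 𝒬↭) (covers v))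

  module _ (osc : OutSemicomplete D) where

    -- The first vertices of as and bs are out-neighbours of x, hence adjacent: whichever arc
    -- joins them decides which one comes next.
    merge : ∀ x (as bs : List V) → Walk D (x ∷ as) → Walk D (x ∷ bs) → Unique (as ++ bs) →
            ∃ λ ms → Walk D (x ∷ ms) × ms ↭ as ++ bs
    merge x []         bs _ wb _ = bs , wb , ↭-refl
    merge x as@(_ ∷ _) [] wa _ _ = as , wa , ↭-reflexive (sym (List.++-identityʳ as))
    merge x (a ∷ as) (b ∷ bs) (xa , wa) (xb , wb) u@(a∉ ∷ u′) =
      [ (λ ab → let ms , w , p = merge a as (b ∷ bs) wa (ab , wb) u′
                in a ∷ ms , (xa , w) , ↭-prep a p)
      , (λ ba → let ms , w , p = merge b (a ∷ as) bs (ba , wa) wb (AllPairs.tail (Unique-resp-↭ b-shift u))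
                in b ∷ ms , (xb , w) , ↭-trans (↭-prep b p) (↭-sym b-shift))
      ]′ (osc x a b xa xb (All.lookup a∉ (∈-++⁺ʳ as (here refl))))
      where
      b-shift : (a ∷ as) ++ b ∷ bs ↭ b ∷ (a ∷ as) ++ bs
      b-shift = shift b (a ∷ as) bs

    spliceAfter : ∀ {u R R′} → u ∈ R → ArcToHead u R′ → Walk D R → Walk D R′ → Unique (R ++ R′) →
                  ∃ λ H → Walk D H × H ↭ R ++ R′ × head H ≡ head R
    spliceAfter {R′ = []} _ ()
    spliceAfter {u} {R′ = R′@(_ ∷ _)} u∈R ur′ wR wR′ uq with ∈-∃++ u∈R
    ... | pre , post , refl
      with merge u post R′ (Walk-++⁻ʳ pre wR) (ur′ , wR′)
             (AllPairs.tail (Unique-++⁻ʳ pre (subst Unique (List.++-assoc pre (u ∷ post) R′) uq)))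
    ... | ms , w , p =
      pre ++ u ∷ ms , Walk-splice pre wR w ,
      ↭-trans (++⁺ˡ pre (↭-prep u p)) (↭-reflexive (sym (List.++-assoc pre (u ∷ post) R′))) ,
      head-++-∷ pre

    rotateTo : ∀ {u r rs} → u ∈ rs → Arc D u r → Walk D (r ∷ rs) → Unique (r ∷ rs) →
               ∃ λ H → Walk D (u ∷ H) × u ∷ H ↭ r ∷ rs
    rotateTo {u} {r} u∈rs ur w uq with ∈-∃++ u∈rs
    ... | pre , post , refl
      with merge u (r ∷ pre) post (ur , Walk-++⁻ˡ (r ∷ pre) w) (Walk-++⁻ʳ (r ∷ pre) w)
             (AllPairs.tail (Unique-resp-↭ (shift u (r ∷ pre) post) uq))
    ... | ms , w′ , p = ms , w′ , ↭-trans (↭-prep u p) (↭-sym (shift u (r ∷ pre) post))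

    record Absorption (𝒬 : List (List V)) (R : List V) : Set where
      field
        host joined   : List V
        others        : List (List V)
        split         : 𝒬 ↭ R ∷ host ∷ others
        R-nonempty    : 0 < length R
        host-nonempty : 0 < length host
        joined↭       : joined ↭ host ++ R
        head-joined   : head joined ≡ head host
        forest        : IsLinearForest (joined ∷ others)
        concat↭       : concat (joined ∷ others) ↭ concat 𝒬

      length-joined : length joined ≡ length host + length R
      length-joined = trans (↭-length joined↭) (List.length-++ host)

    absorb : ∀ {𝒬 R u} → IsLinearForest 𝒬 → R ∈ 𝒬 → u ∈ concat 𝒬 → u ∉ R → ArcToHead u R → Absorption 𝒬 R
    absorb {𝒬} {R} F R∈𝒬 u∈𝒬 u∉R uR with ∈-concat-elsewhere R∈𝒬 u∈𝒬 u∉R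
    ... | host , others , u∈host , split with IsLinearForest-resp-↭ split F
    ... | (wR ∷ wHost ∷ wOthers) , unique
      with spliceAfter u∈host uR wHost wR (Unique-++⁻ˡ (host ++ R) (Unique-resp-↭ (↭-swap-++ R host) unique))
    ... | joined , wJoined , joined↭ , head-joined = record
      { host = host ; joined = joined ; others = others ; split = split
      ; R-nonempty = ArcToHead⇒length>0 uR
      ; host-nonempty = ∈⇒length>0 u∈host
      ; joined↭ = joined↭ ; head-joined = head-joined
      ; forest = wJoined ∷ wOthers , Unique-resp-↭ (↭-sym concat↭) (proj₂ F)
      ; concat↭ = concat↭
      }
      where
      concat↭ : concat (joined ∷ others) ↭ concat 𝒬
      concat↭ = ↭-trans (++⁺ʳ (concat others) joined↭)
                  (↭-trans (↭-sym (↭-swap-++ R host)) (↭-sym (concat⁺ split)))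

    mergeable⇒absorption : ∀ {𝒫} → IsLinearForest 𝒫 → Mergeable 𝒫 → ∃ λ R → Absorption 𝒫 R
    mergeable⇒absorption F mergeable with find mergeable
    ... | R , R∈𝒫 , arcIntoR with find arcIntoR
    ... | u , u∈𝒫 , uR , u∉R = R , absorb F R∈𝒫 u∈𝒫 u∉R uR

    module _ {𝒬 R} (α : Absorption 𝒬 R) where
      open Absorption α

      private
        joined-norm : ∀ K → norm K (joined ∷ others) ≡ (length host + length R) ⊓ K + norm K others
        joined-norm K = cong (λ m → m ⊓ K + norm K others) length-joined

        absorbed-norm : ∀ K → norm K 𝒬 ≡ (length host ⊓ K + length R ⊓ K) + norm K others
        absorbed-norm K = trans (norm-↭ K split) (x∙yz≈yx∙z (length R ⊓ K) (length host ⊓ K) (norm K others))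

      absorption-norm-≤ : ∀ K → norm K (joined ∷ others) ≤ norm K 𝒬
      absorption-norm-≤ K = subst₂ _≤_ (sym (joined-norm K)) (sym (absorbed-norm K))
                              (+-monoˡ-≤ (norm K others) (⊓-subadditive (length host) (length R) K))

      absorption-norm-< : ∀ {K} → 0 < K → K < length host + length R → norm K (joined ∷ others) < norm K 𝒬
      absorption-norm-< {K} K>0 K<h+r = subst₂ _<_ (sym (joined-norm K)) (sym (absorbed-norm K))
        (+-monoˡ-< (norm K others) (⊓-strictly-subadditive host-nonempty R-nonempty K>0 K<h+r))

      absorption-fewer-paths : length (joined ∷ others) < length 𝒬
      absorption-fewer-paths = subst (length (joined ∷ others) <_) (sym (↭-length split)) (n<1+n _)

      improvable-from-absorption : ∀ {K} → Improvable K (joined ∷ others) → Improvable K 𝒬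
      improvable-from-absorption {K} (𝒬′ , F′ , 𝒬′↭ , 𝒬′<) =
        𝒬′ , F′ , ↭-trans 𝒬′↭ concat↭ , <-≤-trans 𝒬′< (absorption-norm-≤ K)

      colourable-from-absorption : ∀ {K} → length host + length R ≤ K →
                                   Colourable K (joined ∷ others) → Colourable K 𝒬
      colourable-from-absorption {K} short (c , isColouring , rainbowJoined ∷ rainbows) =
        c , isColouring , All-resp-↭ (↭-sym split) (within (∈-++⁺ʳ host) ∷ within ∈-++⁺ˡ ∷ rainbows)
        where
        whole : Rainbow c joined
        whole = subst (Rainbow c) (List.take-all K joined (subst (_≤ K) (sym length-joined) short)) rainbowJoined
        within : ∀ {P} → P ⊆ host ++ R → Rainbow c (take K P)
        within P⊆ = Rainbow-⊆ (∈-resp-↭ (↭-sym joined↭) ∘ P⊆ ∘ take-⊆ K _) whole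

      absorbing : ∀ {K} → 0 < K → ImprovableOrColourable K (joined ∷ others) → ImprovableOrColourable K 𝒬
      absorbing {K} K>0 result with K <? length host + length R
      ... | yes long  = inj₁ (joined ∷ others , forest , concat↭ , absorption-norm-< K>0 long)
      ... | no  short = Sum.map improvable-from-absorption (colourable-from-absorption (≮⇒≥ short)) result

    module Lift {𝒫 : List (List V)} (F : IsLinearForest 𝒫) (k : ℕ) where

      private
        L S L′ : List V
        L  = concat 𝒫
        S  = heads 𝒫
        L′ = concat (tails 𝒫)

      Precedes : V → V → Set
      Precedes u v = Any (Consecutive u v) 𝒫

      Precedes⇒Arc : ∀ {u v} → Precedes u v → Arc D u v
      Precedes⇒Arc {u} {v} = All.lookupWith {R = λ _ → Arc D u v} Consecutive⇒Arc (proj₁ F)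

      Precedes⇒position-< : ∀ {u v} → Precedes u v → position u L < position v L
      Precedes⇒position-< u→v = position-< (proj₂ F) (Consecutive-concat 𝒫 u→v)

      Precedes-functional : ∀ {u v v′} → Precedes u v → Precedes u v′ → v ≡ v′
      Precedes-functional u→v u→v′ =
        Consecutive-functional (proj₂ F) (Consecutive-concat 𝒫 u→v) (Consecutive-concat 𝒫 u→v′)

      Anchored : List V → List V → Set
      Anchored Sr []      = ⊤
      Anchored Sr (r ∷ _) = ∃ λ s → s ∈ Sr × Precedes s r

      Dangling : List V → Set
      Dangling []      = ⊥
      Dangling (r ∷ _) = ∃ λ u → u ∈ L′ × Precedes u r

      anchored-or-dangling : ∀ {R} → R ⊆ L′ → Anchored S R ⊎ Dangling R
      anchored-or-dangling {[]}    _     = inj₁ tt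
      anchored-or-dangling {r ∷ _} R⊆L′ with predecessor-in-tails 𝒫 (R⊆L′ (here refl))
      ... | u , u→r
        with ∈-++⁻ S (∈-resp-↭ (concat-↭-heads++tails 𝒫) (Consecutive⇒∈ˡ (Consecutive-concat 𝒫 u→r)))
      ... | inj₁ u∈S  = inj₁ (u , u∈S , u→r)
      ... | inj₂ u∈L′ = inj₂ (u , u∈L′ , u→r)

      -- μ decreases under both reshaping steps: rotation moves a head to an earlier vertex of
      -- concat 𝒫, and splicing deletes one head while keeping the other.
      headPosition : List V → ℕ
      headPosition R = maybe (λ r → position r L) 0 (head R)

      μ : List (List V) → ℕ
      μ 𝒬 = sum (map (suc ∘ headPosition) 𝒬)

      μ-↭ : ∀ {𝒬 𝒬′} → 𝒬 ↭ 𝒬′ → μ 𝒬 ≡ μ 𝒬′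
      μ-↭ p = sum-↭ (map⁺ (suc ∘ headPosition) p)

      NoWorse : List (List V) → List (List V) → Set
      NoWorse 𝒬′ 𝒬 = IsLinearForest 𝒬′ × concat 𝒬′ ↭ concat 𝒬 × norm k 𝒬′ ≤ norm k 𝒬

      NoWorse-trans : ∀ {𝒬″ 𝒬′ 𝒬} → NoWorse 𝒬″ 𝒬′ → NoWorse 𝒬′ 𝒬 → NoWorse 𝒬″ 𝒬
      NoWorse-trans (F″ , p , ≤₁) (_ , q , ≤₂) = F″ , ↭-trans p q , ≤-trans ≤₁ ≤₂

      Progress : List (List V) → Set
      Progress 𝒬 = ∃ λ 𝒬′ → NoWorse 𝒬′ 𝒬 × μ 𝒬′ < μ 𝒬

      rotate-step : ∀ {𝒬 r rs u} → IsLinearForest 𝒬 → r ∷ rs ∈ 𝒬 → u ∈ rs → Precedes u r → Progress 𝒬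
      rotate-step {𝒬} {r} {rs} {u} F𝒬 R∈𝒬 u∈rs u→r with ∈⇒↭∷ R∈𝒬
      ... | rest , 𝒬↭ with IsLinearForest-resp-↭ 𝒬↭ F𝒬
      ... | (wR ∷ wRest) , unique with rotateTo u∈rs (Precedes⇒Arc u→r) wR (Unique-++⁻ˡ (r ∷ rs) unique)
      ... | H , wH , H↭ = (u ∷ H) ∷ rest , (forest , concat↭ , ≤-reflexive same-norm) , μ<
        where
        concat↭ : concat ((u ∷ H) ∷ rest) ↭ concat 𝒬
        concat↭ = ↭-trans (++⁺ʳ (concat rest) H↭) (↭-sym (concat⁺ 𝒬↭))
        forest : IsLinearForest ((u ∷ H) ∷ rest)
        forest = (wH ∷ wRest) , Unique-resp-↭ (↭-sym concat↭) (proj₂ F𝒬)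
        same-norm : norm k ((u ∷ H) ∷ rest) ≡ norm k 𝒬
        same-norm = trans (cong (λ m → m ⊓ k + norm k rest) (↭-length H↭)) (sym (norm-↭ k 𝒬↭))
        μ< : μ ((u ∷ H) ∷ rest) < μ 𝒬
        μ< = subst (μ ((u ∷ H) ∷ rest) <_) (sym (μ-↭ 𝒬↭))
               (+-monoˡ-< (μ rest) (s≤s (Precedes⇒position-< u→r)))

      absorb-step : ∀ {𝒬 r rs u} → IsLinearForest 𝒬 → r ∷ rs ∈ 𝒬 → u ∈ concat 𝒬 → u ∉ r ∷ rs →
                    Precedes u r → Progress 𝒬
      absorb-step {𝒬} {r} {rs} F𝒬 R∈𝒬 u∈𝒬 u∉R u→r =
        joined ∷ others , (forest , concat↭ , absorption-norm-≤ α k) , μ<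
        where
        α : Absorption 𝒬 (r ∷ rs)
        α = absorb F𝒬 R∈𝒬 u∈𝒬 u∉R (Precedes⇒Arc u→r)
        open Absorption α
        open ≤-Reasoning
        μ< : μ (joined ∷ others) < μ 𝒬
        μ< = begin-strict
          μ (joined ∷ others)
            ≡⟨ cong (λ h → suc (maybe _ 0 h) + μ others) head-joined ⟩
          suc (headPosition host) + μ others
            <⟨ m<n+m _ z<s ⟩
          suc (position r L) + (suc (headPosition host) + μ others)
            ≡⟨ sym (μ-↭ split) ⟩
          μ 𝒬 ∎

      dangling-step : ∀ {𝒬 R} → IsLinearForest 𝒬 → concat 𝒬 ↭ L′ → R ∈ 𝒬 → Dangling R → Progress 𝒬
      dangling-step {R = r ∷ rs} F𝒬 𝒬↭ R∈𝒬 (u , u∈L′ , u→r) with u ∈? r ∷ rs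
      ... | yes (here refl)  = ⊥-elim (<-irrefl refl (Precedes⇒position-< u→r))
      ... | yes (there u∈rs) = rotate-step F𝒬 R∈𝒬 u∈rs u→r
      ... | no  u∉R          = absorb-step F𝒬 R∈𝒬 (∈-resp-↭ (↭-sym 𝒬↭) u∈L′) u∉R u→r

      anchor : ∀ 𝒬 → Acc _<_ (μ 𝒬) → IsLinearForest 𝒬 → concat 𝒬 ↭ L′ →
               ∃ λ 𝒬′ → NoWorse 𝒬′ 𝒬 × All (Anchored S) 𝒬′
      anchor 𝒬 (acc rec) F𝒬 𝒬↭
        with all-or-any 𝒬 (λ R∈𝒬 → anchored-or-dangling (λ v∈R → ∈-resp-↭ 𝒬↭ (∈-concat⁺′ v∈R R∈𝒬)))
      ... | inj₁ anchored = 𝒬 , (F𝒬 , ↭-refl , ≤-refl) , anchored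
      ... | inj₂ dangling with find dangling
      ... | R , R∈𝒬 , d with dangling-step F𝒬 𝒬↭ R∈𝒬 d
      ... | 𝒬₁ , noWorse₁ , μ< with anchor 𝒬₁ (rec μ<) (proj₁ noWorse₁) (↭-trans (proj₁ (proj₂ noWorse₁)) 𝒬↭)
      ... | 𝒬′ , noWorse′ , anchored = 𝒬′ , NoWorse-trans {𝒬′ = 𝒬₁} {𝒬} noWorse′ noWorse₁ , anchored

      Anchored-transport : ∀ {𝒬 Sr Sr′ s r} → Sr ↭ s ∷ Sr′ → Precedes s r → r ∉ concat 𝒬 →
                           All (Anchored Sr) 𝒬 → All (Anchored Sr′) 𝒬
      Anchored-transport {𝒬} {Sr} {Sr′} Sr↭ s→r r∉𝒬 anchored =
        All.tabulate (λ R∈𝒬 → transport R∈𝒬 (All.lookup anchored R∈𝒬))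
        where
        transport : ∀ {R} → R ∈ 𝒬 → Anchored Sr R → Anchored Sr′ R
        transport {[]}     _    _                       = tt
        transport {r′ ∷ _} R∈𝒬 (s′ , s′∈Sr , s′→r′) with ∈-resp-↭ Sr↭ s′∈Sr
        ... | here refl    =
          ⊥-elim (r∉𝒬 (subst (_∈ concat 𝒬) (Precedes-functional s′→r′ s→r) (∈-concat⁺′ (here refl) R∈𝒬)))
        ... | there s′∈Sr′ = s′ , s′∈Sr′ , s′→r′

      prepend : ∀ 𝒬 Sr → IsLinearForest 𝒬 → All (Anchored Sr) 𝒬 →
                ∃ λ 𝒬′ → All (Walk D) 𝒬′ × concat 𝒬′ ↭ Sr ++ concat 𝒬 × norm (suc k) 𝒬′ ≤ norm k 𝒬 + length Sr
      prepend [] Sr _ _ =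
        map [_] Sr , All.map⁺ (All.universal (λ _ → tt) Sr) ,
        ↭-reflexive (trans (List.concat-map-[_] Sr) (sym (List.++-identityʳ Sr))) , ≤-reflexive (norm-singletons Sr)
        where
        norm-singletons : ∀ xs → norm (suc k) (map [_] xs) ≡ length xs
        norm-singletons []       = refl
        norm-singletons (x ∷ xs) = cong suc (norm-singletons xs)
      prepend ([] ∷ 𝒬) Sr ((_ ∷ walks) , unique) (_ ∷ anchored) = prepend 𝒬 Sr (walks , unique) anchored
      prepend ((r ∷ rs) ∷ 𝒬) Sr ((wR ∷ walks) , unique) ((s , s∈Sr , s→r) ∷ anchored) with ∈⇒↭∷ s∈Sr
      ... | Sr′ , Sr↭
        with prepend 𝒬 Sr′ (walks , Unique-++⁻ʳ (r ∷ rs) unique)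
               (Anchored-transport Sr↭ s→r (λ r∈𝒬 → Unique-++⇒Disjoint (r ∷ rs) unique (here refl , r∈𝒬)) anchored)
      ... | 𝒬′ , walks′ , 𝒬′↭ , norm≤ = (s ∷ r ∷ rs) ∷ 𝒬′ , (Precedes⇒Arc s→r , wR) ∷ walks′ , vertices , norm≤′
        where
        R : List V
        R = r ∷ rs
        vertices : s ∷ R ++ concat 𝒬′ ↭ Sr ++ R ++ concat 𝒬
        vertices = ↭-trans (↭-prep s (↭-trans (++⁺ˡ R 𝒬′↭) (shifts R Sr′))) (++⁺ʳ (R ++ concat 𝒬) (↭-sym Sr↭))
        a N : ℕ
        a = length R ⊓ k
        N = norm k 𝒬
        open ≤-Reasoning
        norm≤′ : suc (a + norm (suc k) 𝒬′) ≤ (a + N) + length Sr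
        norm≤′ = begin
          suc (a + norm (suc k) 𝒬′)     ≤⟨ s≤s (+-monoʳ-≤ a norm≤) ⟩
          suc (a + (N + length Sr′))    ≡⟨ cong suc (sym (+-assoc a N (length Sr′))) ⟩
          suc ((a + N) + length Sr′)    ≡⟨ sym (+-suc (a + N) (length Sr′)) ⟩
          (a + N) + suc (length Sr′)    ≡⟨ cong ((a + N) +_) (sym (↭-length Sr↭)) ⟩
          (a + N) + length Sr           ∎

      lift : Improvable k (tails 𝒫) → Improvable (suc k) 𝒫
      lift (𝒬 , F𝒬 , 𝒬↭ , 𝒬<) with anchor 𝒬 (<-wellFounded (μ 𝒬)) F𝒬 𝒬↭
      ... | 𝒬ₐ , (Fₐ , 𝒬ₐ↭ , ≤ₐ) , anchored with prepend 𝒬ₐ S Fₐ anchored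
      ... | 𝒬′ , walks′ , 𝒬′↭ , norm≤ = 𝒬′ , (walks′ , Unique-resp-↭ (↭-sym vertices) (proj₂ F)) , vertices , norm<
        where
        vertices : concat 𝒬′ ↭ L
        vertices = ↭-trans 𝒬′↭ (↭-trans (++⁺ˡ S (↭-trans 𝒬ₐ↭ 𝒬↭)) (↭-sym (concat-↭-heads++tails 𝒫)))
        open ≤-Reasoning
        norm< : norm (suc k) 𝒬′ < norm (suc k) 𝒫
        norm< = begin-strict
          norm (suc k) 𝒬′                 ≤⟨ norm≤ ⟩
          norm k 𝒬ₐ + length S            ≤⟨ +-monoˡ-≤ (length S) ≤ₐ ⟩
          norm k 𝒬 + length S             <⟨ +-monoˡ-< (length S) 𝒬< ⟩
          norm k (tails 𝒫) + length S     ≡⟨ +-comm (norm k (tails 𝒫)) (length S) ⟩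
          length S + norm k (tails 𝒫)     ≡⟨ sym (norm-heads+tails k 𝒫) ⟩
          norm (suc k) 𝒫                  ∎

    improvable-or-colourable-step : ∀ {k 𝒫} → IsLinearForest 𝒫 →
      (∀ {𝒬} → length 𝒬 < length 𝒫 → IsLinearForest 𝒬 → ImprovableOrColourable (suc k) 𝒬) →
      ImprovableOrColourable k (tails 𝒫) → ImprovableOrColourable (suc k) 𝒫
    improvable-or-colourable-step {k} {𝒫} F fewerPaths tailsResult with mergeable? 𝒫
    ... | yes mergeable =
      let R , α = mergeable⇒absorption F mergeable
      in absorbing α z<s (fewerPaths (absorption-fewer-paths α) (Absorption.forest α))
    ... | no ¬mergeable =
      Sum.map (Lift.lift F k) (colourable-by-heads F (¬mergeable⇒unmergeable ¬mergeable)) tailsResult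

    improvable-or-colourable : ∀ K 𝒫 → Acc _<_ (length 𝒫) → IsLinearForest 𝒫 → ImprovableOrColourable K 𝒫
    improvable-or-colourable zero    𝒫 _         _ = inj₂ (uncoloured 𝒫)
    improvable-or-colourable (suc k) 𝒫 (acc rec) F =
      improvable-or-colourable-step F (λ fewer → improvable-or-colourable (suc k) _ (rec fewer))
        (improvable-or-colourable k (tails 𝒫) (<-wellFounded _) (tails-isLinearForest F))

corollary2p4 : ∀ {n} (D : Digraph n) (k : ℕ) → 1 ≤ k → OutSemicomplete D →
    (𝒫 : List (List (Fin n))) → KOptimal D k 𝒫 →
    Σ (Colouring n k) λ c → IsPartialColouring D c × Orthogonal k 𝒫 c
corollary2p4 D k _ osc 𝒫 optimal
  with improvable-or-colourable D osc k 𝒫 (<-wellFounded _) (isPathPartition⇒isLinearForest D (proj₁ optimal))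
... | inj₁ improvable                  = ⊥-elim (k-optimal⇒¬improvable D optimal improvable)
... | inj₂ (c , isColouring , rainbows) = c , isColouring , rainbows⇒orthogonal D (proj₁ (proj₁ optimal)) rainbows
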